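{- Let $\lambda$ be a partition. For a row-strict semi-standard Young tableau $T$ of shape $\lambda$, the procedure $\rho$ described in the context is well defined, $\rho(T)$ is a semi-standard Young row-strict composition tableau (SSYRT) of some shape $\alpha$ with $\operatorname{shape}(\alpha)=\lambda$, and $\rho$ is a weight-preserving bijection from the set of row-strict semi-standard Young tableaux of shape $\lambda$ onto the set of all SSYRT of shape $\alpha$, where $\alpha$ ranges over all compositions with $\operatorname{shape}(\alpha)=\lambda$.
   Context: Diagrams use the French convention: the diagram of a sequence of positive integers $(\alpha_1,\dots,\alpha_\ell)$ has $\alpha_i$ left-justified cells in the $i$-th row from the bottom; cell $(i,j)$ is in row $i$ (counted from the bottom) and column $j$ (counted from the left). A composition is a finite sequence $\alpha=(\alpha_1,\dots,\alpha_\ell)$ of positive integers, $\ell(\alpha)=\ell$; $\operatorname{shape}(\alpha)$ is the partition obtained by sorting its parts into weakly decreasing order. A row-strict semi-standard Young tableau of shape a partition $\lambda$ is a filling of the diagram of $\lambda$ with positive integers that strictly increase from left to right along rows and weakly increase from bottom to top in columns. An SSYRT of shape $\alpha$ is a filling $T$ of the diagram of $\alpha$ with positive integers such that, setting $T(i,j)=\infty$ for cells $(i,j)$ not in the diagram: (1) entries strictly increase from left to right along each row; (2) entries of the leftmost column weakly decrease from top to bottom; (3) for all $1\le i<j\le \ell(\alpha)$ and $1\le k<m$, where $m$ is the largest part of $\alpha$, if $T(j,k)<T(i,k+1)$ then $T(j,k+1)\le T(i,k+1)$. The weight of a filling is $x^T=\prod_t x_t^{v_t}$, $v_t$ the number of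 entries equal to $t$. The map $\rho$: given a row-strict semi-standard Young tableau $T$ of shape $\lambda$, build $\rho(T)$ column by column. Place the entries of the first column of $T$ into the first column of $\rho(T)$ (rows $1,\dots$, one entry per row) in weakly decreasing order from top to bottom. Once the first $k-1$ columns of $\rho(T)$ are built, place the entries of the $k$-th column of $T$ into column $k$ of $\rho(T)$ one at a time, from smallest to largest: an entry $e$ is placed in cell $(i,k)$ for the highest row $i$ such that $(i,k)$ does not already contain an entry and the cell $(i,k-1)$ contains an entry strictly smaller than $e$. -}

module Defs where

open import Data.Nat using (ℕ; zero; suc; _≤_; _<_; _≥_; _⊔_; _<ᵇ_; _≡ᵇ_; _≟_)
open import Data.Bool using (Bool; true; false; if_then_else_; _∧_)
open import Data.List using (List; []; _∷_; _++_; [_]; length; map; mapMaybe; concat; filter; reverse; upTo; drop; foldr)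
open import Data.List.Relation.Unary.All using (All)
open import Data.List.Relation.Unary.Linked using (Linked)
open import Data.Maybe using (Maybe; just; nothing; _>>=_)
open import Data.Unit using (⊤)
open import Data.Empty using (⊥)
open import Relation.Binary.PropositionalEquality using (_≡_)

-- A filling of a diagram: list of rows, row 1 (bottom) first; each row read left to right.
Filling : Set
Filling = List (List ℕ)

IsPartition : List ℕ → Set
IsPartition λ′ = All (λ a → 1 ≤ a) λ′ × Linked _≥_ λ′
  where open import Data.Product using (_×_)

IsComposition : List ℕ → Set
IsComposition α = All (λ a → 1 ≤ a) α

insertDesc : ℕ → List ℕ → List ℕ
insertDesc x [] = x ∷ []
insertDesc x (y ∷ ys) = if y <ᵇ x then x ∷ y ∷ ys else y ∷ insertDesc x ys

sortDesc : List ℕ → List ℕ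
sortDesc = foldr insertDesc []

shape : List ℕ → List ℕ
shape = sortDesc

sortAsc : List ℕ → List ℕ
sortAsc xs = reverse (sortDesc xs)

maxPart : List ℕ → ℕ
maxPart = foldr _⊔_ 0

at : {A : Set} → List A → ℕ → Maybe A
at [] _ = nothing
at (x ∷ xs) zero = just x
at (x ∷ xs) (suc n) = at xs n

-- T(i,j): row i from the bottom, column j from the left (1-indexed)
cell : Filling → ℕ → ℕ → Maybe ℕ
cell T zero j = nothing
cell T (suc i) zero = nothing
cell T (suc i) (suc j) = at T i >>= λ r → at r j

-- order on ℕ ∪ {∞} (nothing = ∞)
_<∞_ : Maybe ℕ → Maybe ℕ → Set
just a <∞ just b = a < b
just a <∞ nothing = ⊤
nothing <∞ _ = ⊥

_≤∞_ : Maybe ℕ → Maybe ℕ → Set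
just a ≤∞ just b = a ≤ b
_ ≤∞ nothing = ⊤
nothing ≤∞ just _ = ⊥

open import Data.Product using (_×_)

FillingOf : List ℕ → Filling → Set
FillingOf α T = map length T ≡ α × All (All (λ a → 1 ≤ a)) T

RowsStrict : Filling → Set
RowsStrict T = All (Linked _<_) T

RSSYT : List ℕ → Filling → Set
RSSYT λ′ T = FillingOf λ′ T × RowsStrict T
  × (∀ i j a b → cell T i j ≡ just a → cell T (suc i) j ≡ just b → a ≤ b)

SSYRT : List ℕ → Filling → Set
SSYRT α T = FillingOf α T × RowsStrict T
  × (∀ i a b → cell T i 1 ≡ just a → cell T (suc i) 1 ≡ just b → a ≤ b)
  × (∀ i j k → 1 ≤ i → i < j → j ≤ length α → 1 ≤ k → k < maxPart α →
       cell T j k <∞ cell T i (suc k) → cell T j (suc k) ≤∞ cell T i (suc k))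

-- exponent of x_t in the weight x^T
weight : Filling → ℕ → ℕ
weight T t = length (filter (t ≟_) (concat T))

-- The map ρ (partial a priori: nothing if some entry cannot be placed)

-- column j (0-indexed) of T, bottom to top
column : ℕ → Filling → List ℕ
column j T = mapMaybe (λ r → at r j) T

lastOf : List ℕ → Maybe ℕ
lastOf [] = nothing
lastOf (x ∷ []) = just x
lastOf (x ∷ y ∷ ys) = lastOf (y ∷ ys)

-- row r may receive e in column k+1 (0-indexed k): cell (·,k+1) empty,
-- i.e. r has exactly k entries, and cell (·,k) holds an entry < e
fits : ℕ → ℕ → List ℕ → Bool
fits k e r = (length r ≡ᵇ k) ∧ (Data.Maybe.maybe (λ x → x <ᵇ e) false (lastOf r))
  where import Data.Maybe

-- place e in the highest admissible row
place : ℕ → ℕ → Filling → Maybe Filling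
place k e [] = nothing
place k e (r ∷ rs) with place k e rs
... | just rs′ = just (r ∷ rs′)
... | nothing = if fits k e r then just ((r ++ [ e ]) ∷ rs) else nothing

placeAll : ℕ → List ℕ → Filling → Maybe Filling
placeAll k [] R = just R
placeAll k (e ∷ es) R = place k e R >>= placeAll k es

buildCols : List ℕ → Filling → Filling → Maybe Filling
buildCols [] T R = just R
buildCols (k ∷ ks) T R = placeAll k (sortAsc (column k T)) R >>= buildCols ks T

numCols : Filling → ℕ
numCols T = maxPart (map length T)

ρ : Filling → Maybe Filling
ρ T = buildCols (drop 1 (upTo (numCols T))) T
        (map [_] (sortAsc (column 0 T)))

-- ρ fills column k+1 by placing its entries, smallest first, into the highest row
-- whose column-k entry is smaller. Such a placement succeeds exactly when a Hall-type
-- condition holds: for every x, at most as many new entries are ≤ x as there are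
-- column-k entries < x. In a row-strict tableau this holds because every entry of
-- column k+1 sits to the right of a smaller entry of column k.
-- The greedy placement is characterised by two local properties of the extended rows:
-- each new entry exceeds its left neighbour (row strictness), and if an entry x placed
-- in a lower row also fits a higher row, that higher row received an entry ≤ x (the
-- triple condition). Hence ρ(T) is the unique filling satisfying the SSYRT conditions
-- whose columns are rearrangements of the columns of T. Rearranging columns preserves
-- the weight and the conjugate shape, and sorting the columns of ρ(T) recovers T.
-- Conversely, sorting the columns of an SSYRT R gives a row-strict tableau T, since by
-- the same Hall condition each sorted column dominates the next one entrywise, and
-- ρ(T) = R.

module Submission where

open import Defs
open import Data.Bool using (true; false; if_then_else_)
import Data.Bool as Bool
open import Data.Bool.Properties using (T-≡)
open import Data.Nat using (ℕ; zero; suc; _+_; _≤_; _<_; _≥_; _<ᵇ_; _≡ᵇ_; _≟_; _≤?_; _<?_; z≤n; s≤s)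
open import Data.Nat.Properties
open import Data.List using (List; []; _∷_; _++_; [_]; length; map; mapMaybe; concat; filter; reverse; upTo; drop; take; applyUpTo)
open import Data.List.Properties
  using (map-++; mapMaybe-++; mapMaybe-map; unfold-reverse; reverse-involutive; length-++; length-map; length-take;
         length-drop; ∷-injective; take-all; take-take; map-id-local; filter-accept; filter-reject; filter-none;
         filter-all; filter-++)
open import Data.List.Relation.Unary.All using (All; []; _∷_)
import Data.List.Relation.Unary.All as All
import Data.List.Relation.Unary.All.Properties as AllP
open import Data.List.Relation.Unary.AllPairs using (AllPairs; []; _∷_)
import Data.List.Relation.Unary.AllPairs.Properties as AllPairsP
open import Data.List.Relation.Unary.Linked using (Linked; []; [-]; _∷_)
import Data.List.Relation.Unary.Linked as Linked
open import Data.List.Relation.Unary.Linked.Properties using (Linked⇒All)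
open import Data.List.Relation.Unary.Any using (Any; here; there; any?)
open import Data.List.Relation.Unary.Sorted.TotalOrder ≤-totalOrder using (Sorted)
open import Data.List.Relation.Unary.Sorted.TotalOrder.Properties using (↗↭↗⇒≋)
open import Data.List.Relation.Binary.Pointwise using (Pointwise-≡⇒≡)
open import Data.List.Sort ≤-decTotalOrder using (sort; sort-↭; sort-↗)
open import Data.List.Relation.Binary.Permutation.Propositional using (_↭_; ↭-refl; ↭-sym; ↭-trans; prep; swap; ↭⇒↭ₛ)
open import Data.List.Relation.Binary.Permutation.Propositional.Properties
  using (↭-length; ↭-empty-inv; ↭-reverse; filter-↭; All-resp-↭; ∈-resp-↭; shift; shifts; drop-∷; ++⁺ˡ; ++⁺)
open import Data.Maybe using (Maybe; just; nothing; maybe′)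
open import Data.Maybe.Properties using (just-injective)
open import Data.Product using (Σ; ∃; _×_; _,_; proj₁; proj₂)
open import Data.Sum using (inj₁; inj₂)
open import Data.Empty using (⊥)
open import Data.Unit using (⊤; tt)
open import Function using (_∘_; Equivalence)
open import Relation.Nullary using (¬_; yes; no; contradiction)
open import Relation.Unary using (Decidable; ∁)
open import Relation.Binary.Definitions using (tri<; tri≈; tri>)
open import Relation.Binary.PropositionalEquality using (_≡_; _≢_; refl; sym; trans; cong; cong₂; subst; subst₂)

<⇒<ᵇ≡true : ∀ {m n} → m < n → (m <ᵇ n) ≡ true
<⇒<ᵇ≡true = Equivalence.to T-≡ ∘ <⇒<ᵇ

<ᵇ≡true⇒< : ∀ m n → (m <ᵇ n) ≡ true → m < n
<ᵇ≡true⇒< m n = <ᵇ⇒< m n ∘ Equivalence.from T-≡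

≤⇒<ᵇ≡false : ∀ {m n} → n ≤ m → (m <ᵇ n) ≡ false
≤⇒<ᵇ≡false {m} {n} n≤m with m <ᵇ n in eq
... | false = refl
... | true = contradiction (<ᵇ≡true⇒< m n eq) (≤⇒≯ n≤m)

<ᵇ≡false⇒≥ : ∀ m n → (m <ᵇ n) ≡ false → n ≤ m
<ᵇ≡false⇒≥ m n eq = ≮⇒≥ λ m<n → true≢false (trans (sym (<⇒<ᵇ≡true m<n)) eq)
  where
  true≢false : true ≢ false
  true≢false ()

≡ᵇ≡true⇒≡ : ∀ m n → (m ≡ᵇ n) ≡ true → m ≡ n
≡ᵇ≡true⇒≡ m n = ≡ᵇ⇒≡ m n ∘ Equivalence.from T-≡

≡⇒≡ᵇ≡true : ∀ {m n} → m ≡ n → (m ≡ᵇ n) ≡ true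
≡⇒≡ᵇ≡true {m} {n} = Equivalence.to T-≡ ∘ ≡⇒≡ᵇ m n

count : {A : Set} {P : A → Set} → Decidable P → List A → ℕ
count P? xs = length (filter P? xs)

module _ {A : Set} {P : A → Set} (P? : Decidable P) where

  count-↭ : ∀ {xs ys} → xs ↭ ys → count P? xs ≡ count P? ys
  count-↭ p = ↭-length (filter-↭ P? p)

  count-++ : ∀ xs ys → count P? (xs ++ ys) ≡ count P? xs + count P? ys
  count-++ xs ys = trans (cong length (filter-++ P? xs ys)) (length-++ (filter P? xs))

  count-accept : ∀ {x} xs → P x → count P? (x ∷ xs) ≡ suc (count P? xs)
  count-accept xs px = cong length (filter-accept P? px)

  count-reject : ∀ {x} xs → ¬ P x → count P? (x ∷ xs) ≡ count P? xs
  count-reject xs ¬px = cong length (filter-reject P? ¬px)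

  count-none : ∀ {xs} → All (∁ P) xs → count P? xs ≡ 0
  count-none a = cong length (filter-none P? a)

  count-all : ∀ {xs} → All P xs → count P? xs ≡ length xs
  count-all a = cong length (filter-all P? a)

  count-∷-≤ : ∀ x xs → count P? xs ≤ count P? (x ∷ xs)
  count-∷-≤ x xs with P? x
  ... | yes _ = n≤1+n _
  ... | no _ = ≤-refl

  count>0⇒Any : ∀ xs → 0 < count P? xs → Any P xs
  count>0⇒Any (x ∷ xs) h with P? x
  ... | yes px = here px
  ... | no _ = there (count>0⇒Any xs h)

module _ {A : Set} where

  at-length : ∀ (xs : List A) i {a} → at xs i ≡ just a → i < length xs
  at-length (x ∷ xs) zero _ = s≤s z≤n
  at-length (x ∷ xs) (suc i) h = s≤s (at-length xs i h)

  at≡nothing⇒length≤ : ∀ (xs : List A) i → at xs i ≡ nothing → length xs ≤ i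
  at≡nothing⇒length≤ [] i _ = z≤n
  at≡nothing⇒length≤ (x ∷ xs) (suc i) h = s≤s (at≡nothing⇒length≤ xs i h)

  length≤⇒at≡nothing : ∀ (xs : List A) i → length xs ≤ i → at xs i ≡ nothing
  length≤⇒at≡nothing [] i _ = refl
  length≤⇒at≡nothing (x ∷ xs) (suc i) (s≤s h) = length≤⇒at≡nothing xs i h

  at-defined : ∀ (xs : List A) i → i < length xs → ∃ λ a → at xs i ≡ just a
  at-defined (x ∷ xs) zero _ = x , refl
  at-defined (x ∷ xs) (suc i) (s≤s h) = at-defined xs i h

  at-map : ∀ {B : Set} (f : A → B) xs i {a} → at xs i ≡ just a → at (map f xs) i ≡ just (f a)
  at-map f (x ∷ xs) zero refl = refl
  at-map f (x ∷ xs) (suc i) h = at-map f xs i h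

  All-at : ∀ {P : A → Set} {xs} → All P xs → ∀ i {a} → at xs i ≡ just a → P a
  All-at (p ∷ _) zero refl = p
  All-at (_ ∷ ps) (suc i) e = All-at ps i e

  at-All : ∀ {P : A → Set} xs → (∀ i {a} → at xs i ≡ just a → P a) → All P xs
  at-All [] _ = []
  at-All (x ∷ xs) h = h 0 refl ∷ at-All xs (h ∘ suc)

  at-ext : ∀ (xs ys : List A) → (∀ i → at xs i ≡ at ys i) → xs ≡ ys
  at-ext [] [] h = refl
  at-ext [] (y ∷ ys) h with () ← h 0
  at-ext (x ∷ xs) [] h with () ← h 0
  at-ext (x ∷ xs) (y ∷ ys) h with refl ← h 0 = cong (x ∷_) (at-ext xs ys (h ∘ suc))

  at-take : ∀ {j k} (r : List A) → j < k → at (take k r) j ≡ at r j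
  at-take {k = suc k} [] _ = refl
  at-take {zero} {suc k} (a ∷ r) _ = refl
  at-take {suc j} {suc k} (a ∷ r) (s≤s h) = at-take r h

  at-snoc : ∀ (r : List A) x → at (r ++ [ x ]) (length r) ≡ just x
  at-snoc [] x = refl
  at-snoc (a ∷ r) x = at-snoc r x

  at-snoc-< : ∀ (r : List A) x j → j < length r → at (r ++ [ x ]) j ≡ at r j
  at-snoc-< (a ∷ r) x zero _ = refl
  at-snoc-< (a ∷ r) x (suc j) (s≤s h) = at-snoc-< r x j h

  length-snoc : ∀ (r : List A) x → length (r ++ [ x ]) ≡ suc (length r)
  length-snoc r x = trans (length-++ r) (+-comm (length r) 1)

  length-take-≤ : ∀ k (r : List A) → k ≤ length r → length (take k r) ≡ k
  length-take-≤ zero r _ = refl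
  length-take-≤ (suc k) (a ∷ r) (s≤s h) = cong suc (length-take-≤ k r h)

  take-snoc : ∀ (r : List A) x → take (length r) (r ++ [ x ]) ≡ r
  take-snoc [] x = refl
  take-snoc (a ∷ r) x = cong (a ∷_) (take-snoc r x)

  module _ {R : A → A → Set} where

    Linked⇒at : ∀ {xs} → Linked R xs → ∀ i {a b} → at xs i ≡ just a → at xs (suc i) ≡ just b → R a b
    Linked⇒at (h ∷ l) zero refl refl = h
    Linked⇒at (h ∷ l) (suc i) e₁ e₂ = Linked⇒at l i e₁ e₂

    at⇒Linked : ∀ xs → (∀ i {a b} → at xs i ≡ just a → at xs (suc i) ≡ just b → R a b) → Linked R xs
    at⇒Linked [] h = []
    at⇒Linked (x ∷ []) h = [-]
    at⇒Linked (x ∷ y ∷ xs) h = h 0 refl refl ∷ at⇒Linked (y ∷ xs) (h ∘ suc)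

    AllPairs⇒at : ∀ {xs} → AllPairs R xs → ∀ i j {a b} → i < j → at xs i ≡ just a → at xs j ≡ just b → R a b
    AllPairs⇒at (h ∷ _) zero (suc j) _ refl e = All-at h j e
    AllPairs⇒at (_ ∷ ap) (suc i) (suc j) (s≤s lt) e₁ e₂ = AllPairs⇒at ap i j lt e₁ e₂

    at⇒AllPairs : ∀ xs → (∀ i j {a b} → i < j → at xs i ≡ just a → at xs j ≡ just b → R a b) → AllPairs R xs
    at⇒AllPairs [] h = []
    at⇒AllPairs (x ∷ xs) h =
      at-All xs (λ j → h 0 (suc j) (s≤s z≤n) refl) ∷ at⇒AllPairs xs (λ i j lt → h (suc i) (suc j) (s≤s lt))

lastOf-snoc : ∀ r x → lastOf (r ++ [ x ]) ≡ just x
lastOf-snoc [] x = refl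
lastOf-snoc (a ∷ []) x = refl
lastOf-snoc (a ∷ b ∷ r) x = lastOf-snoc (b ∷ r) x

lastOf-at : ∀ k (r : List ℕ) → length r ≡ suc k → lastOf r ≡ at r k
lastOf-at zero (a ∷ []) _ = refl
lastOf-at (suc k) (a ∷ b ∷ r) h = lastOf-at k (b ∷ r) (suc-injective h)

lastOf-take : ∀ k (r : List ℕ) → k < length r → lastOf (take (suc k) r) ≡ at r k
lastOf-take k r h = trans (lastOf-at k (take (suc k) r) (length-take-≤ (suc k) r h)) (at-take r ≤-refl)

sorted-↭⇒≡ : ∀ {xs ys} → Sorted xs → Sorted ys → xs ↭ ys → xs ≡ ys
sorted-↭⇒≡ sx sy p = Pointwise-≡⇒≡ (↗↭↗⇒≋ ≤-totalOrder sx sy (↭⇒↭ₛ p))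

Sorted⇒All≥head : ∀ {x xs} → Sorted (x ∷ xs) → All (x ≤_) xs
Sorted⇒All≥head {xs = []} _ = []
Sorted⇒All≥head {xs = _ ∷ _} (x≤y ∷ s) = Linked⇒All ≤-trans x≤y s

Desc⇒All≤head : ∀ {x xs} → Linked _≥_ (x ∷ xs) → All (_≤ x) xs
Desc⇒All≤head {xs = []} _ = []
Desc⇒All≤head {xs = _ ∷ _} (x≥y ∷ d) = Linked⇒All (λ p q → ≤-trans q p) x≥y d

Desc-cons : ∀ {x ys} → All (_≤ x) ys → Linked _≥_ ys → Linked _≥_ (x ∷ ys)
Desc-cons [] _ = [-]
Desc-cons (y≤x ∷ _) d = y≤x ∷ d

insertDesc-↭ : ∀ x ys → insertDesc x ys ↭ x ∷ ys
insertDesc-↭ x [] = ↭-refl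
insertDesc-↭ x (y ∷ ys) with y <ᵇ x
... | true = ↭-refl
... | false = ↭-trans (prep y (insertDesc-↭ x ys)) (swap y x ↭-refl)

sortDesc-↭ : ∀ xs → sortDesc xs ↭ xs
sortDesc-↭ [] = ↭-refl
sortDesc-↭ (x ∷ xs) = ↭-trans (insertDesc-↭ x (sortDesc xs)) (prep x (sortDesc-↭ xs))

insertDesc-desc : ∀ x {ys} → Linked _≥_ ys → Linked _≥_ (insertDesc x ys)
insertDesc-desc x [] = [-]
insertDesc-desc x {y ∷ ys} d with y <ᵇ x in eq
... | true = <⇒≤ (<ᵇ≡true⇒< y x eq) ∷ d
... | false = Desc-cons (All-resp-↭ (↭-sym (insertDesc-↭ x ys)) (<ᵇ≡false⇒≥ y x eq ∷ Desc⇒All≤head d))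
                        (insertDesc-desc x (Linked.tail d))

sortDesc-desc : ∀ xs → Linked _≥_ (sortDesc xs)
sortDesc-desc [] = []
sortDesc-desc (x ∷ xs) = insertDesc-desc x (sortDesc-desc xs)

insertDesc-≤all : ∀ x ys → All (x ≤_) ys → insertDesc x ys ≡ ys ++ [ x ]
insertDesc-≤all x [] [] = refl
insertDesc-≤all x (y ∷ ys) (x≤y ∷ a) rewrite ≤⇒<ᵇ≡false x≤y = cong (y ∷_) (insertDesc-≤all x ys a)

sortDesc-sorted : ∀ {xs} → Sorted xs → sortDesc xs ≡ reverse xs
sortDesc-sorted {[]} _ = refl
sortDesc-sorted {x ∷ xs} s rewrite sortDesc-sorted (Linked.tail s) | unfold-reverse x xs =
  insertDesc-≤all x (reverse xs) (All-resp-↭ (↭-sym (↭-reverse xs)) (Sorted⇒All≥head s))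

sortAsc-sorted : ∀ {xs} → Sorted xs → sortAsc xs ≡ xs
sortAsc-sorted {xs} s rewrite sortDesc-sorted s = reverse-involutive xs

conjugate-injective : ∀ {xs ys} → Linked _≥_ xs → Linked _≥_ ys → length xs ≡ length ys →
  (∀ j → count (j <?_) xs ≡ count (j <?_) ys) → xs ≡ ys
conjugate-injective {[]} {[]} _ _ _ _ = refl
conjugate-injective {x ∷ xs} {y ∷ ys} dx dy l h with heads
  where
  nothing-exceeds-head : ∀ {z zs} → Linked _≥_ (z ∷ zs) → count (z <?_) (z ∷ zs) ≡ 0
  nothing-exceeds-head d = count-none (_ <?_) (All.map ≤⇒≯ (≤-refl ∷ Desc⇒All≤head d))
  heads : x ≡ y
  heads with <-cmp x y
  ... | tri≈ _ x≡y _ = x≡y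
  ... | tri< x<y _ _ = contradiction
          (trans (sym (nothing-exceeds-head dx)) (trans (h x) (count-accept (x <?_) ys x<y))) 0≢1+n
  ... | tri> _ _ y<x = contradiction
          (trans (sym (count-accept (y <?_) xs y<x)) (trans (h y) (nothing-exceeds-head dy))) 1+n≢0
... | refl = cong (x ∷_) (conjugate-injective (Linked.tail dx) (Linked.tail dy) (suc-injective l) tails)
  where
  tails : ∀ j → count (j <?_) xs ≡ count (j <?_) ys
  tails j with j <? x
  ... | yes j<x = suc-injective
          (trans (sym (count-accept (j <?_) xs j<x)) (trans (h j) (count-accept (j <?_) ys j<x)))
  ... | no j≮x = trans (sym (count-reject (j <?_) xs j≮x)) (trans (h j) (count-reject (j <?_) ys j≮x))

module _ {A B : Set} (f : A → Maybe B) where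

  mapMaybe-∷-just : ∀ x xs {y} → f x ≡ just y → mapMaybe f (x ∷ xs) ≡ y ∷ mapMaybe f xs
  mapMaybe-∷-just x xs e rewrite e = refl

  mapMaybe-∷-nothing : ∀ x xs → f x ≡ nothing → mapMaybe f (x ∷ xs) ≡ mapMaybe f xs
  mapMaybe-∷-nothing x xs e rewrite e = refl

maxPart-bound : ∀ xs → All (_≤ maxPart xs) xs
maxPart-bound [] = []
maxPart-bound (x ∷ xs) = m≤m⊔n x (maxPart xs) ∷ All.map (λ h → ≤-trans h (m≤n⊔m x (maxPart xs))) (maxPart-bound xs)

rows≤numCols : ∀ T → All (λ r → length r ≤ numCols T) T
rows≤numCols T = AllP.map⁻ (maxPart-bound (map length T))

column-short : ∀ j X → All (λ r → length r ≤ j) X → column j X ≡ []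
column-short j [] [] = refl
column-short j (r ∷ X) (l ∷ ls) =
  trans (mapMaybe-∷-nothing (λ r → at r j) r X (length≤⇒at≡nothing r j l)) (column-short j X ls)

column≡[]⇒short : ∀ j X → column j X ≡ [] → All (λ r → length r ≤ j) X
column≡[]⇒short j [] _ = []
column≡[]⇒short j (r ∷ X) h with at r j in e
... | nothing = at≡nothing⇒length≤ r j e ∷ column≡[]⇒short j X h

length-column : ∀ j X → length (column j X) ≡ count (j <?_) (map length X)
length-column j [] = refl
length-column j (r ∷ X) with at r j in e
... | nothing = trans (length-column j X) (sym (count-reject (j <?_) _ (≤⇒≯ (at≡nothing⇒length≤ r j e))))
... | just a = trans (cong suc (length-column j X)) (sym (count-accept (j <?_) _ (at-length r j e)))

column-take : ∀ {j k} R → j < k → column j (map (take k) R) ≡ column j R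
column-take [] _ = refl
column-take {j} (r ∷ R) j<k rewrite at-take r j<k with at r j
... | nothing = column-take R j<k
... | just a = cong (a ∷_) (column-take R j<k)

record LastSplit {A : Set} (P : A → Set) (xs : List A) : Set where
  constructor lastSplit
  field
    before : List A
    pivot : A
    after : List A
    split : xs ≡ before ++ pivot ∷ after
    pivot-holds : P pivot
    after-fails : All (∁ P) after

last-occurrence : ∀ {A : Set} {P : A → Set} → Decidable P → ∀ xs → Any P xs → LastSplit P xs
last-occurrence P? (x ∷ xs) any with any? P? xs
... | yes a with lastSplit X z Y refl pz nY ← last-occurrence P? xs a = lastSplit (x ∷ X) z Y refl pz nY
... | no ¬a = lastSplit [] x xs refl (here-only any) (AllP.¬Any⇒All¬ xs ¬a)
  where
  here-only : Any _ (x ∷ xs) → _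
  here-only (here px) = px
  here-only (there a) = contradiction a ¬a

module _ {A : Set} where

  All-update : ∀ {P : A → Set} X {p p′} Y → All P (X ++ p ∷ Y) → P p′ → All P (X ++ p′ ∷ Y)
  All-update [] Y (_ ∷ a) q = q ∷ a
  All-update (x ∷ X) Y (h ∷ a) q = h ∷ All-update X Y a q

  AllPairs-update : ∀ {R : A → A → Set} X {p p′} Y → AllPairs R (X ++ p ∷ Y) →
    All (λ a → R a p′) X → All (R p′) Y → AllPairs R (X ++ p′ ∷ Y)
  AllPairs-update [] Y (_ ∷ ap) [] rY = rY ∷ ap
  AllPairs-update (x ∷ X) Y (h ∷ ap) (q ∷ qs) rY = All-update X Y h q ∷ AllPairs-update X Y ap qs rY

  AllPairs-pivot : ∀ {R : A → A → Set} X {p} Y → AllPairs R (X ++ p ∷ Y) → All (R p) Y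
  AllPairs-pivot [] Y (h ∷ _) = h
  AllPairs-pivot (x ∷ X) Y (_ ∷ ap) = AllPairs-pivot X Y ap

  map≡++∷ : ∀ {B : Set} (f : A → B) P X z Y → map f P ≡ X ++ z ∷ Y →
    ∃ λ X′ → ∃ λ p → ∃ λ Y′ → P ≡ X′ ++ p ∷ Y′ × map f X′ ≡ X × f p ≡ z × map f Y′ ≡ Y
  map≡++∷ f (p ∷ P) [] z Y h with refl , refl ← ∷-injective h = [] , p , P , refl , refl , refl , refl
  map≡++∷ f (p ∷ P) (x ∷ X) z Y h with ∷-injective h
  ... | refl , e with map≡++∷ f P X z Y e
  ...   | X′ , q , Y′ , refl , refl , refl , refl = p ∷ X′ , q , Y′ , refl , refl , refl , refl

fits⁺ : ∀ {k x} r {c} → length r ≡ k → lastOf r ≡ just c → c < x → fits k x r ≡ true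
fits⁺ {k} r refl e c<x rewrite ≡⇒≡ᵇ≡true {k} refl | e = <⇒<ᵇ≡true c<x

fits⁻ : ∀ k x r → fits k x r ≡ true → length r ≡ k × ∃ λ c → lastOf r ≡ just c × c < x
fits⁻ k x r h with length r ≡ᵇ k in e₁ | lastOf r
... | true | just c = ≡ᵇ≡true⇒≡ _ _ e₁ , c , refl , <ᵇ≡true⇒< c x h

fits-length : ∀ {k} x r → fits k x r ≡ true → length r ≡ k
fits-length {k} x r = proj₁ ∘ fits⁻ k x r

snoc-fits-not : ∀ {k} x r e → length r ≡ k → fits k x (r ++ [ e ]) ≢ true
snoc-fits-not x r e refl f = 1+n≢n (trans (sym (length-snoc r e)) (fits-length x (r ++ [ e ]) f))

place-none : ∀ {k e rs} → All (λ r → fits k e r ≡ false) rs → place k e rs ≡ nothing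
place-none [] = refl
place-none {k} {e} (f ∷ a) rewrite place-none {k} {e} a | f = refl

place-here : ∀ {k e r rs} → fits k e r ≡ true → place k e rs ≡ nothing → place k e (r ∷ rs) ≡ just ((r ++ [ e ]) ∷ rs)
place-here f n rewrite n | f = refl

place-++ : ∀ {k e} X {Z Z′} → place k e Z ≡ just Z′ → place k e (X ++ Z) ≡ just (X ++ Z′)
place-++ [] h = h
place-++ {k} {e} (x ∷ X) {Z} {Z′} h rewrite place-++ {k} {e} X {Z} {Z′} h = refl

-- A row of the part built so far, with the entry (if any) it receives in the next column.
RowExt : Set
RowExt = List ℕ × Maybe ℕ

extend : List ℕ → Maybe ℕ → List ℕ
extend r nothing = r
extend r (just x) = r ++ [ x ]

prefixes : List RowExt → Filling
prefixes = map proj₁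

extensions : List RowExt → Filling
extensions = map λ (r , n) → extend r n

newEntries : List RowExt → List ℕ
newEntries = mapMaybe proj₂

Admissible : ℕ → RowExt → Set
Admissible k (r , n) = ∀ x → n ≡ just x → fits k x r ≡ true

-- The greedy rule passes over a higher row admitting x only if that row has already
-- received a smaller or equal entry.
Blocked : ℕ → RowExt → RowExt → Set
Blocked k (_ , n) (r′ , n′) = ∀ x → n ≡ just x → fits k x r′ ≡ true → ∃ λ y → n′ ≡ just y × y ≤ x

record Greedy (k : ℕ) (P : List RowExt) : Set where
  constructor greedy
  field
    admissible : All (Admissible k) P
    blocked : AllPairs (Blocked k) P

newEntries-++ : ∀ X Y → newEntries (X ++ Y) ≡ newEntries X ++ newEntries Y
newEntries-++ X Y = mapMaybe-++ proj₂ X Y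

newEntries-All : ∀ {Q : ℕ → Set} P → All Q (newEntries P) → All (λ p → ∀ y → proj₂ p ≡ just y → Q y) P
newEntries-All [] [] = []
newEntries-All ((r , nothing) ∷ P) a = (λ _ ()) ∷ newEntries-All P a
newEntries-All ((r , just x) ∷ P) (q ∷ a) = (λ { _ refl → q }) ∷ newEntries-All P a

newEntries-Any : ∀ {e} P → Any (e ≡_) (newEntries P) → Any (λ p → proj₂ p ≡ just e) P
newEntries-Any ((r , nothing) ∷ P) h = there (newEntries-Any P h)
newEntries-Any ((r , just x) ∷ P) (here refl) = here refl
newEntries-Any ((r , just x) ∷ P) (there h) = there (newEntries-Any P h)

newEntries≡[] : ∀ P → newEntries P ≡ [] → extensions P ≡ prefixes P
newEntries≡[] [] _ = refl
newEntries≡[] ((r , nothing) ∷ P) h = cong (r ∷_) (newEntries≡[] P h)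

receives? : ∀ e → Decidable (λ (p : RowExt) → proj₂ p ≡ just e)
receives? e (_ , nothing) = no λ ()
receives? e (_ , just x) with x ≟ e
... | yes refl = yes refl
... | no x≢e = no λ { refl → x≢e refl }

module PlaceMinimum {k e es} (A : List RowExt) (r₀ : List ℕ) (B : List RowExt)
  (sorted : Sorted (e ∷ es)) (g : Greedy k (A ++ (r₀ , just e) ∷ B))
  (perm : newEntries (A ++ (r₀ , just e) ∷ B) ↭ e ∷ es)
  (last : All (λ p → proj₂ p ≢ just e) B) where

  open Greedy g

  filled : List RowExt
  filled = A ++ (r₀ ++ [ e ] , nothing) ∷ B

  r₀-admits : fits k e r₀ ≡ true
  r₀-admits = All.head (AllP.++⁻ʳ A admissible) e refl

  B-entries≥e : All (λ p → ∀ y → proj₂ p ≡ just y → e ≤ y) B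
  B-entries≥e = newEntries-All B (All.tail (AllP.++⁻ʳ (newEntries A)
    (subst (All (e ≤_)) (newEntries-++ A _) (All-resp-↭ (↭-sym perm) (≤-refl ∷ Sorted⇒All≥head sorted)))))

  higher-rows-refuse : ∀ C → All (Blocked k (r₀ , just e)) C → All (λ p → ∀ y → proj₂ p ≡ just y → e ≤ y) C →
    All (λ p → proj₂ p ≢ just e) C → All (λ r → fits k e r ≡ false) (prefixes C)
  higher-rows-refuse [] [] [] [] = []
  higher-rows-refuse ((r , n) ∷ C) (bl ∷ bls) (ge ∷ ges) (ne ∷ nes) = refuses ∷ higher-rows-refuse C bls ges nes
    where
    refuses : fits k e r ≡ false
    refuses with fits k e r in eq
    ... | false = refl
    ... | true with y , refl , y≤e ← bl e refl eq = contradiction (cong just (≤-antisym y≤e (ge y refl))) ne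

  place-minimum : place k e (prefixes (A ++ (r₀ , just e) ∷ B)) ≡ just (prefixes filled)
  place-minimum rewrite map-++ proj₁ A ((r₀ , just e) ∷ B) | map-++ proj₁ A ((r₀ ++ [ e ] , nothing) ∷ B) =
    place-++ (prefixes A) (place-here r₀-admits (place-none (higher-rows-refuse B (AllPairs-pivot A B blocked) B-entries≥e last)))

  extensions-filled : extensions filled ≡ extensions (A ++ (r₀ , just e) ∷ B)
  extensions-filled = trans (map-++ _ A _) (sym (map-++ _ A _))

  greedy-filled : Greedy k filled
  greedy-filled = greedy (All-update A B admissible λ _ ())
    (AllPairs-update A B blocked
      (All.tabulate λ _ x _ f → contradiction f (snoc-fits-not x r₀ e (fits-length e r₀ r₀-admits)))
      (All.tabulate λ _ _ ()))

  newEntries-filled : newEntries filled ↭ es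
  newEntries-filled = subst (_↭ es) (sym (newEntries-++ A _))
    (drop-∷ (↭-trans (↭-sym (shift e (newEntries A) (newEntries B))) (subst (_↭ e ∷ es) (newEntries-++ A _) perm)))

placeAll-greedy : ∀ {k} es P → Sorted es → Greedy k P → newEntries P ↭ es → placeAll k es (prefixes P) ≡ just (extensions P)
placeAll-greedy [] P _ _ perm = cong just (sym (newEntries≡[] P (↭-empty-inv perm)))
placeAll-greedy (e ∷ es) P s g perm
  with lastSplit A (r₀ , _) B refl refl last ←
       last-occurrence (receives? e) P (newEntries-Any P (∈-resp-↭ (↭-sym perm) (here refl)))
  rewrite PlaceMinimum.place-minimum A r₀ B s g perm last
        | sym (PlaceMinimum.extensions-filled A r₀ B s g perm last)
  = placeAll-greedy es _ (Linked.tail s)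
      (PlaceMinimum.greedy-filled A r₀ B s g perm last) (PlaceMinimum.newEntries-filled A r₀ B s g perm last)

openEnd : ℕ → List ℕ → Maybe ℕ
openEnd k r = if length r ≡ᵇ k then lastOf r else nothing

openEnds : ℕ → Filling → List ℕ
openEnds k = mapMaybe (openEnd k)

openEnd-fits : ∀ {k} r {c e} → openEnd k r ≡ just c → c < e → fits k e r ≡ true
openEnd-fits {k} r h c<e with length r ≡ᵇ k in eq
... | true rewrite h = <⇒<ᵇ≡true c<e

fits-openEnd : ∀ {k} e r → fits k e r ≡ true → ∃ λ c → openEnd k r ≡ just c × c < e
fits-openEnd {k} e r f with fits⁻ k e r f
... | len , c , lastOf≡c , c<e rewrite ≡⇒≡ᵇ≡true len = c , lastOf≡c , c<e

openEnd-snoc : ∀ {k} r e → length r ≡ k → openEnd k (r ++ [ e ]) ≡ nothing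
openEnd-snoc {k} r e refl with length (r ++ [ e ]) ≡ᵇ length r in eq
... | false = refl
... | true = contradiction (trans (sym (length-snoc r e)) (≡ᵇ≡true⇒≡ _ _ eq)) 1+n≢n

openEnds-fits : ∀ {k} e S → Any (_< e) (openEnds k S) → Any (λ r → fits k e r ≡ true) S
openEnds-fits {k} e (r ∷ S) h with openEnd k r in eq
... | nothing = there (openEnds-fits e S h)
openEnds-fits e (r ∷ S) (here c<e) | just c = here (openEnd-fits r eq c<e)
openEnds-fits e (r ∷ S) (there h) | just c = there (openEnds-fits e S h)

Hall : List ℕ → List ℕ → Set
Hall cs es = ∀ x → count (_≤? x) es ≤ count (_<? x) cs

Hall-↭ˡ : ∀ {cs cs′ es} → cs ↭ cs′ → Hall cs es → Hall cs′ es
Hall-↭ˡ p h x = subst (_ ≤_) (count-↭ (_<? x) p) (h x)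

Hall-↭ʳ : ∀ {cs es es′} → es ↭ es′ → Hall cs es → Hall cs es′
Hall-↭ʳ p h x = subst (_≤ _) (count-↭ (_≤? x) p) (h x)

Hall-cons⇒< : ∀ {cs e es} → Hall cs (e ∷ es) → Any (_< e) cs
Hall-cons⇒< {cs} {e} {es} h =
  count>0⇒Any (_<? e) cs (≤-trans (s≤s z≤n) (subst (_≤ _) (count-accept (_≤? e) es ≤-refl) (h e)))

Hall-drop : ∀ {e es c} X Y → c < e → Sorted (e ∷ es) → Hall (X ++ c ∷ Y) (e ∷ es) → Hall (X ++ Y) es
Hall-drop {e} {es} {c} X Y c<e s h x with e ≤? x
... | yes e≤x = ≤-pred (begin
  suc (count (_≤? x) es)         ≡⟨ count-accept (_≤? x) es e≤x ⟨
  count (_≤? x) (e ∷ es)         ≤⟨ h x ⟩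
  count (_<? x) (X ++ c ∷ Y)     ≡⟨ count-++ (_<? x) X (c ∷ Y) ⟩
  count (_<? x) X + count (_<? x) (c ∷ Y)         ≡⟨ cong (count (_<? x) X +_) (count-accept (_<? x) Y (<-≤-trans c<e e≤x)) ⟩
  count (_<? x) X + suc (count (_<? x) Y)         ≡⟨ +-suc _ _ ⟩
  suc (count (_<? x) X + count (_<? x) Y)         ≡⟨ cong suc (count-++ (_<? x) X Y) ⟨
  suc (count (_<? x) (X ++ Y))   ∎)
  where open ≤-Reasoning
... | no e≰x =
  subst (_≤ _) (sym (count-none (_≤? x) (All.map (λ e≤y y≤x → e≰x (≤-trans e≤y y≤x)) (Sorted⇒All≥head s)))) z≤n

GreedyExtension : ℕ → List ℕ → Filling → Set
GreedyExtension k es S = ∃ λ P → prefixes P ≡ S × Greedy k P × newEntries P ↭ es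

no-extension : ∀ k S → GreedyExtension k [] S
no-extension k [] = [] , refl , greedy [] [] , ↭-refl
no-extension k (r ∷ S) with P , refl , greedy a b , perm ← no-extension k S =
  (r , nothing) ∷ P , refl , greedy ((λ _ ()) ∷ a) (All.tabulate (λ _ _ ()) ∷ b) , perm

module AddMinimum {k e es} (X : Filling) (r₀ : List ℕ) (Y : Filling) (sorted : Sorted (e ∷ es))
  (r₀-fits : fits k e r₀ ≡ true) (Y-refuses : All (λ r → fits k e r ≢ true) Y) where

  length-r₀ : length r₀ ≡ k
  length-r₀ = fits-length e r₀ r₀-fits

  Hall-filled : Hall (openEnds k (X ++ r₀ ∷ Y)) (e ∷ es) → Hall (openEnds k (X ++ (r₀ ++ [ e ]) ∷ Y)) es
  Hall-filled hall with c , end≡c , c<e ← fits-openEnd e r₀ r₀-fits = subst (λ cs → Hall cs es) (sym ends-filled)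
    (Hall-drop (openEnds k X) (openEnds k Y) c<e sorted (subst (λ cs → Hall cs (e ∷ es)) ends hall))
    where
    ends : openEnds k (X ++ r₀ ∷ Y) ≡ openEnds k X ++ c ∷ openEnds k Y
    ends = trans (mapMaybe-++ (openEnd k) X (r₀ ∷ Y)) (cong (openEnds k X ++_) (mapMaybe-∷-just (openEnd k) r₀ Y end≡c))
    ends-filled : openEnds k (X ++ (r₀ ++ [ e ]) ∷ Y) ≡ openEnds k X ++ openEnds k Y
    ends-filled = trans (mapMaybe-++ (openEnd k) X _)
      (cong (openEnds k X ++_) (mapMaybe-∷-nothing (openEnd k) (r₀ ++ [ e ]) Y (openEnd-snoc r₀ e length-r₀)))

  filled-unextended : ∀ n → Admissible k (r₀ ++ [ e ] , n) → n ≡ nothing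
  filled-unextended nothing _ = refl
  filled-unextended (just x) adm = contradiction (adm x refl) (snoc-fits-not x r₀ e length-r₀)

  add-minimum : GreedyExtension k es (X ++ (r₀ ++ [ e ]) ∷ Y) → GreedyExtension k (e ∷ es) (X ++ r₀ ∷ Y)
  add-minimum (P′ , prefixes≡ , greedy admissible′ blocked′ , perm′)
    with X′ , (_ , n) , Y′ , refl , refl , refl , refl ← map≡++∷ proj₁ P′ X (r₀ ++ [ e ]) Y prefixes≡
    with refl ← filled-unextended n (All.head (AllP.++⁻ʳ X′ admissible′)) =
    X′ ++ (r₀ , just e) ∷ Y′ , map-++ proj₁ X′ _ ,
    greedy (All-update X′ Y′ admissible′ λ { _ refl → r₀-fits })
      (AllPairs-update X′ Y′ blocked′ (All.map (λ ge x eq _ → e , refl , ge x eq) (newEntries-All X′ X′-entries≥e))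
        (All.map (λ refuses → λ { _ refl fits → contradiction fits refuses }) (AllP.map⁻ Y-refuses))) ,
    subst (_↭ e ∷ es) (sym (newEntries-++ X′ ((r₀ , just e) ∷ Y′)))
      (↭-trans (shift e (newEntries X′) (newEntries Y′)) (prep e (subst (_↭ es) split-entries perm′)))
    where
    split-entries : newEntries (X′ ++ (r₀ ++ [ e ] , nothing) ∷ Y′) ≡ newEntries X′ ++ newEntries Y′
    split-entries = newEntries-++ X′ _
    X′-entries≥e : All (e ≤_) (newEntries X′)
    X′-entries≥e = AllP.++⁻ˡ (newEntries X′)
      (subst (All (e ≤_)) split-entries (All-resp-↭ (↭-sym perm′) (Sorted⇒All≥head sorted)))

greedy-exists : ∀ k es S → Sorted es → Hall (openEnds k S) es → GreedyExtension k es S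
greedy-exists k [] S _ _ = no-extension k S
greedy-exists k (e ∷ es) S s hall
  with lastSplit X r₀ Y refl r₀-fits Y-refuses ←
       last-occurrence (λ r → fits k e r Bool.≟ true) S (openEnds-fits e S (Hall-cons⇒< hall))
  = AddMinimum.add-minimum X r₀ Y s r₀-fits Y-refuses
      (greedy-exists k es _ (Linked.tail s) (AddMinimum.Hall-filled X r₀ Y s r₀-fits Y-refuses hall))

cut : ℕ → Filling → List RowExt
cut k = map λ r → take k r , at r k

prefixes-cut : ∀ k R → prefixes (cut k R) ≡ map (take k) R
prefixes-cut k [] = refl
prefixes-cut k (r ∷ R) = cong (take k r ∷_) (prefixes-cut k R)

take-suc : ∀ j (r : List ℕ) → take (suc j) r ≡ extend (take j r) (at r j)
take-suc zero [] = refl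
take-suc zero (a ∷ r) = refl
take-suc (suc j) [] = refl
take-suc (suc j) (a ∷ r) = trans (cong (a ∷_) (take-suc j r)) (extend-∷ (take j r) (at r j))
  where
  extend-∷ : ∀ b n → a ∷ extend b n ≡ extend (a ∷ b) n
  extend-∷ b nothing = refl
  extend-∷ b (just x) = refl

extensions-cut : ∀ k R → extensions (cut k R) ≡ map (take (suc k)) R
extensions-cut k [] = refl
extensions-cut k (r ∷ R) = cong₂ _∷_ (sym (take-suc k r)) (extensions-cut k R)

newEntries-cut : ∀ k R → newEntries (cut k R) ≡ column k R
newEntries-cut k R = mapMaybe-map proj₂ (λ r → take k r , at r k) R

take-extend : ∀ k r b n → length b ≤ k → (∀ x → n ≡ just x → length b ≡ k) →
  take (suc k) r ≡ extend b n → take k r ≡ b × at r k ≡ n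
take-extend k r b nothing b≤k _ h =
  trans (sym (trans (take-take k (suc k) r) (cong (λ i → take i r) (m≤n⇒m⊓n≡m (n≤1+n k)))))
        (trans (cong (take k) h) (take-all k b b≤k)) ,
  trans (sym (at-take r ≤-refl)) (trans (cong (λ z → at z k) h) (length≤⇒at≡nothing b k b≤k))
take-extend k r b (just x) _ full h with refl ← full x refl =
  trans (sym (trans (take-take k (suc k) r) (cong (λ i → take i r) (m≤n⇒m⊓n≡m (n≤1+n k)))))
        (trans (cong (take k) h) (take-snoc b x)) ,
  trans (sym (at-take r ≤-refl)) (trans (cong (λ z → at z k) h) (at-snoc b x))

cut-unique : ∀ k R P → map (take (suc k)) R ≡ extensions P → All (λ b → length b ≤ k) (prefixes P) →
  All (Admissible k) P → cut k R ≡ P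
cut-unique k [] [] _ _ _ = refl
cut-unique k (r ∷ R) ((b , n) ∷ P) h (b≤k ∷ bs≤k) (adm ∷ adms) with h₁ , h′ ← ∷-injective h
  with refl , refl ← take-extend k r b n b≤k (λ x e → fits-length x b (adm x e)) h₁ =
  cong (_ ∷_) (cut-unique k R P h′ bs≤k adms)

openEnds-extensions : ∀ k P → All (λ b → length b ≤ k) (prefixes P) → All (Admissible k) P →
  openEnds (suc k) (extensions P) ≡ newEntries P
openEnds-extensions k [] _ _ = refl
openEnds-extensions k ((b , nothing) ∷ P) (b≤k ∷ bs≤k) (_ ∷ adms) =
  trans (mapMaybe-∷-nothing (openEnd (suc k)) b (extensions P) short) (openEnds-extensions k P bs≤k adms)
  where
  short : openEnd (suc k) b ≡ nothing
  short with length b ≡ᵇ suc k in eq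
  ... | false = refl
  ... | true = contradiction (subst (_≤ k) (≡ᵇ≡true⇒≡ _ _ eq) b≤k) 1+n≰n
openEnds-extensions k ((b , just x) ∷ P) (_ ∷ bs≤k) (adm ∷ adms) =
  trans (mapMaybe-∷-just (openEnd (suc k)) (b ++ [ x ]) (extensions P) full) (cong (x ∷_) (openEnds-extensions k P bs≤k adms))
  where
  full : openEnd (suc k) (b ++ [ x ]) ≡ just x
  full rewrite length-snoc b x | fits-length x b (adm x refl) | ≡⇒≡ᵇ≡true {k} refl = lastOf-snoc b x

extensions-length : ∀ k P → All (λ b → length b ≤ k) (prefixes P) → All (λ r → length r ≤ suc k) (extensions P)
extensions-length k [] _ = []
extensions-length k ((b , nothing) ∷ P) (b≤k ∷ bs) = m≤n⇒m≤1+n b≤k ∷ extensions-length k P bs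
extensions-length k ((b , just x) ∷ P) (b≤k ∷ bs) =
  ≤-trans (≤-reflexive (length-snoc b x)) (s≤s b≤k) ∷ extensions-length k P bs

greedy-cut-short : ∀ j S → All (λ r → length r ≤ j) S → Greedy j (cut j S)
greedy-cut-short j [] [] = greedy [] []
greedy-cut-short j (r ∷ S) (l ∷ ls) with greedy a b ← greedy-cut-short j S ls =
  greedy ((λ x e → no-entry e) ∷ a) (All.tabulate (λ _ x e _ → no-entry e) ∷ b)
  where
  no-entry : ∀ {A : Set} {x} → at r j ≡ just x → A
  no-entry e with () ← trans (sym e) (length≤⇒at≡nothing r j l)

module Forward (T : Filling) (m : ℕ) (hall : ∀ k → Hall (column k T) (column (suc k) T))
  (sorted : ∀ k → Sorted (column k T)) (beyond : ∀ j → m ≤ j → column j T ≡ []) where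

  ColumnOK : ℕ → Filling → Set
  ColumnOK j R = Greedy j (cut j R) × column j R ↭ column j T

  complete : ∀ n k S → m ≤ suc k + n → All (λ r → length r ≤ suc k) S → openEnds (suc k) S ↭ column k T →
    ∃ λ R → map (take (suc k)) R ≡ S × (∀ j → suc k ≤ j → ColumnOK j R)
  complete zero k S m≤ S≤ _ = S , map-id-local (All.map (take-all (suc k) _) S≤) , done
    where
    done : ∀ j → suc k ≤ j → ColumnOK j S
    done j k<j = greedy-cut-short j S S≤j ,
      subst₂ _↭_ (sym (column-short j S S≤j)) (sym (beyond j (≤-trans (≤-trans m≤ (≤-reflexive (+-identityʳ _))) k<j)))
        ↭-refl
      where
      S≤j : All (λ r → length r ≤ j) S
      S≤j = All.map (λ l → ≤-trans l k<j) S≤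
  complete (suc n) k S m≤ S≤ ends
    with P , refl , g , perm ← greedy-exists (suc k) (column (suc k) T) S (sorted (suc k))
                                  (Hall-↭ˡ {es = column (suc k) T} (↭-sym ends) (hall k))
    with R , R≡ , ok ← complete n (suc k) (extensions P) (≤-trans m≤ (≤-reflexive (+-suc (suc k) n)))
           (extensions-length (suc k) P S≤)
           (subst (_↭ column (suc k) T) (sym (openEnds-extensions (suc k) P S≤ (Greedy.admissible g))) perm)
    = R , trans (sym (prefixes-cut (suc k) R)) (cong prefixes cut≡P) , ok′
    where
    cut≡P : cut (suc k) R ≡ P
    cut≡P = cut-unique (suc k) R P R≡ S≤ (Greedy.admissible g)
    ok′ : ∀ j → suc k ≤ j → ColumnOK j R
    ok′ j k<j with m≤n⇒m<n∨m≡n k<j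
    ... | inj₁ k+1<j = ok j k+1<j
    ... | inj₂ refl = subst (Greedy (suc k)) (sym cut≡P) g ,
                      subst (_↭ column (suc k) T) (trans (cong newEntries (sym cut≡P)) (newEntries-cut (suc k) R)) perm

row-step : ∀ {r : List ℕ} → Linked _<_ r → ∀ k {b} → at r (suc k) ≡ just b → ∃ λ a → at r k ≡ just a × a < b
row-step {r} l k e with a , ea ← at-defined r k (<-trans (n<1+n k) (at-length r (suc k) e)) = a , ea , Linked⇒at l k ea e

rowsStrict⇒Hall : ∀ X → RowsStrict X → ∀ k → Hall (column k X) (column (suc k) X)
rowsStrict⇒Hall [] [] k x = z≤n
rowsStrict⇒Hall (r ∷ X) (l ∷ ls) k x = row (at r k) (at r (suc k)) (row-step l k) (rowsStrict⇒Hall X ls k x)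
  where
  grow : ∀ ma → count (_<? x) (column k X) ≤ count (_<? x) (maybe′ _∷_ (λ ys → ys) ma (column k X))
  grow nothing = ≤-refl
  grow (just a) = count-∷-≤ (_<? x) a (column k X)
  row : ∀ ma mb → (∀ {b} → mb ≡ just b → ∃ λ a → ma ≡ just a × a < b) →
    count (_≤? x) (column (suc k) X) ≤ count (_<? x) (column k X) →
    count (_≤? x) (maybe′ _∷_ (λ ys → ys) mb (column (suc k) X)) ≤ count (_<? x) (maybe′ _∷_ (λ ys → ys) ma (column k X))
  row ma nothing _ ih = ≤-trans ih (grow ma)
  row ma (just b) step ih with a , refl , a<b ← step refl with b ≤? x
  ... | yes b≤x = subst₂ _≤_ (sym (count-accept (_≤? x) _ b≤x)) (sym (count-accept (_<? x) _ (<-≤-trans a<b b≤x))) (s≤s ih)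
  ... | no b≰x = subst (_≤ _) (sym (count-reject (_≤? x) _ b≰x)) (≤-trans ih (grow (just a)))

strict⇒admissible : ∀ j R → RowsStrict R → All (Admissible (suc j)) (cut (suc j) R)
strict⇒admissible j [] [] = []
strict⇒admissible j (r ∷ R) (l ∷ ls) = admissible ∷ strict⇒admissible j R ls
  where
  admissible : ∀ x → at r (suc j) ≡ just x → fits (suc j) x (take (suc j) r) ≡ true
  admissible x e with a , ea , a<x ← row-step l j e =
    fits⁺ (take (suc j) r) (length-take-≤ (suc j) r (<⇒≤ (at-length r (suc j) e)))
      (trans (lastOf-take j r (<-trans (n<1+n j) (at-length r (suc j) e))) ea) a<x

admissible⇒strict : ∀ R → (∀ j → All (Admissible (suc j)) (cut (suc j) R)) → RowsStrict R
admissible⇒strict [] _ = []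
admissible⇒strict (r ∷ R) adm = at⇒Linked r increases ∷ admissible⇒strict R (All.tail ∘ adm)
  where
  increases : ∀ j {a b} → at r j ≡ just a → at r (suc j) ≡ just b → a < b
  increases j {b = b} ea eb with _ , c , lastOf≡c , c<b ← fits⁻ (suc j) b (take (suc j) r) (All.head (adm j) b eb)
    with refl ← trans (sym lastOf≡c) (trans (lastOf-take j r (at-length r j ea)) ea) = c<b

record GreedyTableau (R : Filling) : Set where
  field
    nonempty : All (λ r → 1 ≤ length r) R
    strict : RowsStrict R
    first-sorted : Sorted (column 0 R)
    blocked : ∀ k → AllPairs (Blocked (suc k)) (cut (suc k) R)

  greedy-cut : ∀ k → Greedy (suc k) (cut (suc k) R)
  greedy-cut k = greedy (strict⇒admissible k R strict) (blocked k)

singletons : List ℕ → Filling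
singletons = map [_]

column-singletons : ∀ xs → column 0 (singletons xs) ≡ xs
column-singletons [] = refl
column-singletons (x ∷ xs) = cong (x ∷_) (column-singletons xs)

openEnds-singletons : ∀ xs → openEnds 1 (singletons xs) ≡ xs
openEnds-singletons [] = refl
openEnds-singletons (x ∷ xs) = cong (x ∷_) (openEnds-singletons xs)

take-1≡singletons : ∀ R → All (λ r → 1 ≤ length r) R → map (take 1) R ≡ singletons (column 0 R)
take-1≡singletons [] [] = refl
take-1≡singletons ((a ∷ r) ∷ R) (_ ∷ ls) = cong ([ a ] ∷_) (take-1≡singletons R ls)

take-1≡singletons⇒nonempty : ∀ R xs → map (take 1) R ≡ singletons xs → All (λ r → 1 ≤ length r) R
take-1≡singletons⇒nonempty [] [] _ = []
take-1≡singletons⇒nonempty ((a ∷ r) ∷ R) (x ∷ xs) h =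
  s≤s z≤n ∷ take-1≡singletons⇒nonempty R xs (proj₂ (∷-injective h))

module Backward (T R : Filling) where

  Step : ℕ → Set
  Step j = placeAll j (sortAsc (column j T)) (map (take j) R) ≡ just (map (take (suc j)) R)

  place-column : ∀ j → Sorted (column j T) → column j R ↭ column j T → Greedy j (cut j R) → Step j
  place-column j s perm g rewrite sortAsc-sorted s =
    subst₂ (λ S S′ → placeAll j (column j T) S ≡ just S′) (prefixes-cut j R) (extensions-cut j R)
      (placeAll-greedy (column j T) (cut j R) s g (subst (_↭ column j T) (sym (newEntries-cut j R)) perm))

  buildCols-steps : ∀ n k (f : ℕ → ℕ) → (∀ i → f i ≡ k + i) → (∀ j → k ≤ j → Step j) →
    buildCols (applyUpTo f n) T (map (take k) R) ≡ just (map (take (k + n)) R)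
  buildCols-steps zero k f _ _ = cong (λ i → just (map (take i) R)) (sym (+-identityʳ k))
  buildCols-steps (suc n) k f f≡ steps rewrite trans (f≡ 0) (+-identityʳ k) | steps k ≤-refl =
    trans (buildCols-steps n (suc k) (f ∘ suc) (λ i → trans (f≡ (suc i)) (+-suc k i))
             (λ j k<j → steps j (≤-trans (n≤1+n k) k<j)))
          (cong (λ i → just (map (take i) R)) (sym (+-suc k n)))

  buildCols-all : ∀ m → All (λ r → length r ≤ m) R → map (take 1) R ≡ singletons (sortAsc (column 0 T)) →
    (∀ j → Step (suc j)) → buildCols (drop 1 (upTo m)) T (singletons (sortAsc (column 0 T))) ≡ just R
  buildCols-all zero R≤ first _ rewrite sym first = cong just (map-id-local (All.map (take-all 1 _ ∘ λ l → ≤-trans l z≤n) R≤))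
  buildCols-all (suc m) R≤ first steps rewrite sym first =
    trans (buildCols-steps m 1 suc (λ _ → refl) λ { (suc j) _ → steps j })
          (cong just (map-id-local (All.map (take-all (suc m) _) R≤)))

ρ≡just : ∀ T R → (∀ j → Sorted (column j T)) → GreedyTableau R → (∀ j → column j R ↭ column j T) → ρ T ≡ just R
ρ≡just T R sorted tab perm = buildCols-all (numCols T) R≤ first steps
  where
  open Backward T R
  open GreedyTableau tab
  R≤ : All (λ r → length r ≤ numCols T) R
  R≤ = column≡[]⇒short (numCols T) R
         (↭-empty-inv (subst (column (numCols T) R ↭_) (column-short (numCols T) T (rows≤numCols T)) (perm (numCols T))))
  first : map (take 1) R ≡ singletons (sortAsc (column 0 T))
  first = trans (take-1≡singletons R nonempty)
    (cong singletons (trans (sorted-↭⇒≡ first-sorted (sorted 0) (perm 0)) (sym (sortAsc-sorted (sorted 0)))))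
  steps : ∀ j → Step (suc j)
  steps j = place-column (suc j) (sorted (suc j)) (perm (suc j)) (greedy-cut j)

greedy-tableau-exists : ∀ T → RowsStrict T → (∀ j → Sorted (column j T)) →
  ∃ λ R → GreedyTableau R × (∀ j → column j R ↭ column j T)
greedy-tableau-exists T strict sorted = tableau (complete m 0 (singletons (column 0 T)) (n≤1+n m)
  (AllP.map⁺ (All.universal (λ _ → ≤-refl) (column 0 T)))
  (subst (_↭ column 0 T) (sym (openEnds-singletons (column 0 T))) ↭-refl))
  where
  m : ℕ
  m = numCols T
  beyond : ∀ j → m ≤ j → column j T ≡ []
  beyond j m≤j = column-short j T (All.map (λ l → ≤-trans l m≤j) (rows≤numCols T))
  open Forward T m (rowsStrict⇒Hall T strict) sorted beyond
  tableau : (∃ λ R → map (take 1) R ≡ singletons (column 0 T) × (∀ j → 1 ≤ j → ColumnOK j R)) →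
    ∃ λ R → GreedyTableau R × (∀ j → column j R ↭ column j T)
  tableau (R , first , ok) = R , record
    { nonempty = take-1≡singletons⇒nonempty R _ first
    ; strict = admissible⇒strict R (Greedy.admissible ∘ proj₁ ∘ ok′)
    ; first-sorted = subst Sorted (sym column₀) (sorted 0)
    ; blocked = Greedy.blocked ∘ proj₁ ∘ ok′
    } , perm
    where
    ok′ : ∀ j → ColumnOK (suc j) R
    ok′ j = ok (suc j) (s≤s z≤n)
    column₀ : column 0 R ≡ column 0 T
    column₀ = trans (sym (column-take R (s≤s z≤n))) (trans (cong (column 0) first) (column-singletons (column 0 T)))
    perm : ∀ j → column j R ↭ column j T
    perm zero = subst (_↭ column 0 T) (sym column₀) ↭-refl
    perm (suc j) = proj₂ (ok′ j)

cell-at : ∀ R i k {r} → at R i ≡ just r → cell R (suc i) (suc k) ≡ at r k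
cell-at R i k e rewrite e = refl

cell≡just : ∀ R i k {a} → cell R (suc i) (suc k) ≡ just a → ∃ λ r → at R i ≡ just r × at r k ≡ just a
cell≡just R i k e with at R i
... | just r = r , refl , e

module _ {A : Set} (f : A → Maybe ℕ) where

  Stacked : A → A → Set
  Stacked r r′ = ∀ {b} → f r′ ≡ just b → ∃ λ a → f r ≡ just a × a ≤ b

  mapMaybe-empty : ∀ y ys → Linked Stacked (y ∷ ys) → f y ≡ nothing → mapMaybe f ys ≡ []
  mapMaybe-empty y [] _ _ = refl
  mapMaybe-empty y (z ∷ ys) (st ∷ l) fy with f z in fz
  ... | nothing = mapMaybe-empty z ys l fz
  ... | just b with a , fy′ , _ ← st refl with () ← trans (sym fy′) fy

  Sorted-mapMaybe⁺ : ∀ xs → Linked Stacked xs → Sorted (mapMaybe f xs)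
  Sorted-mapMaybe⁺ [] _ = []
  Sorted-mapMaybe⁺ (x ∷ []) _ with f x
  ... | nothing = []
  ... | just a = [-]
  Sorted-mapMaybe⁺ (x ∷ y ∷ xs) (st ∷ l) with f x in fx
  ... | nothing = Sorted-mapMaybe⁺ (y ∷ xs) l
  ... | just a with f y in fy
  ...   | nothing rewrite mapMaybe-empty y xs l fy = [-]
  ...   | just b with _ , refl , a≤b ← st refl =
    a≤b ∷ subst Sorted (mapMaybe-∷-just f y xs fy) (Sorted-mapMaybe⁺ (y ∷ xs) l)

  Sorted-mapMaybe⁻ : ∀ xs → Sorted (mapMaybe f xs) →
    ∀ i {r r′ a b} → at xs i ≡ just r → at xs (suc i) ≡ just r′ → f r ≡ just a → f r′ ≡ just b → a ≤ b
  Sorted-mapMaybe⁻ (x ∷ y ∷ xs) s zero refl refl fa fb =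
    Linked.head (subst Sorted (trans (mapMaybe-∷-just f x (y ∷ xs) fa) (cong (_ ∷_) (mapMaybe-∷-just f y xs fb))) s)
  Sorted-mapMaybe⁻ (x ∷ xs) s (suc i) = Sorted-mapMaybe⁻ xs (sorted-tail (f x) refl) i
    where
    sorted-tail : ∀ m → f x ≡ m → Sorted (mapMaybe f xs)
    sorted-tail nothing e = subst Sorted (mapMaybe-∷-nothing f x xs e) s
    sorted-tail (just c) e = Linked.tail (subst Sorted (mapMaybe-∷-just f x xs e) s)

WeakColumn : Filling → ℕ → Set
WeakColumn T j = ∀ i a b → cell T i (suc j) ≡ just a → cell T (suc i) (suc j) ≡ just b → a ≤ b

sorted⇒WeakColumn : ∀ T j → Sorted (column j T) → WeakColumn T j
sorted⇒WeakColumn T j s (suc i) a b e₁ e₂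
  with r , er , ra ← cell≡just T i j e₁ | r′ , er′ , rb ← cell≡just T (suc i) j e₂ =
  Sorted-mapMaybe⁻ (λ r → at r j) T s i er er′ ra rb

WeakColumn⇒sorted : ∀ T j → (∀ i {r r′} → at T i ≡ just r → at T (suc i) ≡ just r′ → j < length r′ → j < length r) →
  WeakColumn T j → Sorted (column j T)
WeakColumn⇒sorted T j longer weak = Sorted-mapMaybe⁺ (λ r → at r j) T (at⇒Linked T stacked)
  where
  stacked : ∀ i {r r′} → at T i ≡ just r → at T (suc i) ≡ just r′ → Stacked (λ r → at r j) r r′
  stacked i {r} {r′} e₁ e₂ {b} eb with a , ea ← at-defined r j (longer i e₁ e₂ (at-length r′ j eb)) =
    a , ea , weak (suc i) a b (trans (cell-at T i j e₁) ea) (trans (cell-at T (suc i) j e₂) eb)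

≤∞-nothing : ∀ m → m ≤∞ nothing
≤∞-nothing nothing = tt
≤∞-nothing (just _) = tt

≤∞-just : ∀ m {x} → m ≤∞ just x → ∃ λ y → m ≡ just y × y ≤ x
≤∞-just (just y) y≤x = y , refl , y≤x

Triple : Filling → Set
Triple R = ∀ i j k → i < j → cell R j k <∞ cell R i (suc k) → cell R j (suc k) ≤∞ cell R i (suc k)

blocked⇒Triple : ∀ R → (∀ k → AllPairs (Blocked (suc k)) (cut (suc k) R)) → Triple R
blocked⇒Triple R bl zero j k _ _ = ≤∞-nothing (cell R j (suc k))
blocked⇒Triple R bl (suc i) (suc j) (suc k) (s≤s i<j) prem with at R j in ej | at R i in ei
... | just rj | nothing = ≤∞-nothing (at rj (suc k))
... | just rj | just ri = step (at ri (suc k)) (at rj k) refl prem refl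
  where
  blocked : Blocked (suc k) (take (suc k) ri , at ri (suc k)) (take (suc k) rj , at rj (suc k))
  blocked = AllPairs⇒at (bl k) i j i<j (at-map _ R i ei) (at-map _ R j ej)
  step : ∀ mx mc → at rj k ≡ mc → mc <∞ mx → mx ≡ at ri (suc k) → at rj (suc k) ≤∞ mx
  step (just x) (just c) ec c<x ex with y , ey , y≤x ← blocked x (sym ex)
    (fits⁺ (take (suc k) rj) (length-take-≤ (suc k) rj (at-length rj k ec)) (trans (lastOf-take k rj (at-length rj k ec)) ec) c<x)
    rewrite ey = y≤x
  step nothing mc _ _ _ = ≤∞-nothing (at rj (suc k))

TripleBounded : List ℕ → Filling → Set
TripleBounded α T = ∀ i j k → 1 ≤ i → i < j → j ≤ length α → 1 ≤ k → k < maxPart α →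
  cell T j k <∞ cell T i (suc k) → cell T j (suc k) ≤∞ cell T i (suc k)

TripleBounded⇒blocked : ∀ R → TripleBounded (map length R) R → ∀ k → AllPairs (Blocked (suc k)) (cut (suc k) R)
TripleBounded⇒blocked R triple k = AllPairsP.map⁺ (at⇒AllPairs R blocked)
  where
  blocked : ∀ i j {ri rj} → i < j → at R i ≡ just ri → at R j ≡ just rj →
    Blocked (suc k) (take (suc k) ri , at ri (suc k)) (take (suc k) rj , at rj (suc k))
  blocked i j {ri} {rj} i<j ei ej x ex fits with _ , c , lastOf≡c , c<x ← fits⁻ (suc k) x (take (suc k) rj) fits =
    ≤∞-just (at rj (suc k)) (subst₂ _≤∞_ (cell-at R j (suc k) ej) (trans (cell-at R i (suc k) ei) ex)
      (triple (suc i) (suc j) (suc k) (s≤s z≤n) (s≤s i<j) j<len (s≤s z≤n) k<max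
        (subst₂ _<∞_ (sym (trans (cell-at R j k ej) ec)) (sym (trans (cell-at R i (suc k) ei) ex)) c<x)))
    where
    k<|rj| : suc k ≤ length rj
    k<|rj| = subst (_≤ length rj) (trans (sym (length-take (suc k) rj)) (fits-length x (take (suc k) rj) fits))
      (m⊓n≤n (suc k) (length rj))
    ec : at rj k ≡ just c
    ec = trans (sym (lastOf-take k rj k<|rj|)) lastOf≡c
    j<len : suc j ≤ length (map length R)
    j<len = subst (suc j ≤_) (sym (length-map length R)) (at-length R j ej)
    k<max : suc k < maxPart (map length R)
    k<max = <-≤-trans (at-length ri (suc k) ex) (All-at (AllP.map⁻ (maxPart-bound (map length R))) i ei)

length-column₀ : ∀ X → All (λ r → 1 ≤ length r) X → length (column 0 X) ≡ length X
length-column₀ X nonempty =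
  trans (length-column 0 X) (trans (count-all (0 <?_) (AllP.map⁺ nonempty)) (length-map length X))

shape-by-columns : ∀ R T → length R ≡ length T → Linked _≥_ (map length T) → (∀ j → column j R ↭ column j T) →
  shape (map length R) ≡ map length T
shape-by-columns R T len desc perm = conjugate-injective (sortDesc-desc (map length R)) desc
  (trans (↭-length (sortDesc-↭ (map length R))) (trans (length-map length R) (trans len (sym (length-map length T)))))
  λ j → trans (count-↭ (j <?_) (sortDesc-↭ (map length R)))
          (trans (sym (length-column j R)) (trans (↭-length (perm j)) (length-column j T)))

column-drop-1 : ∀ j X → column j (map (drop 1) X) ≡ column (suc j) X
column-drop-1 j [] = refl
column-drop-1 j ([] ∷ X) = column-drop-1 j X
column-drop-1 j ((a ∷ r) ∷ X) with at r j
... | nothing = column-drop-1 j X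
... | just b = cong (b ∷_) (column-drop-1 j X)

concat-first-column : ∀ X → concat X ↭ column 0 X ++ concat (map (drop 1) X)
concat-first-column [] = ↭-refl
concat-first-column ([] ∷ X) = concat-first-column X
concat-first-column ((a ∷ r) ∷ X) = prep a (↭-trans (++⁺ˡ r (concat-first-column X)) (shifts r (column 0 X)))

concat-↭ : ∀ M X Y → All (λ r → length r ≤ M) X → All (λ r → length r ≤ M) Y →
  (∀ j → column j X ↭ column j Y) → concat X ↭ concat Y
concat-↭ zero X Y X≤ Y≤ _ = subst₂ _↭_ (sym (empty X X≤)) (sym (empty Y Y≤)) ↭-refl
  where
  empty : ∀ Z → All (λ r → length r ≤ 0) Z → concat Z ≡ []
  empty [] [] = refl
  empty ([] ∷ Z) (_ ∷ Z≤) = empty Z Z≤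
concat-↭ (suc M) X Y X≤ Y≤ perm = ↭-trans (concat-first-column X) (↭-trans
  (++⁺ (perm 0) (concat-↭ M (map (drop 1) X) (map (drop 1) Y) (shorter X X≤) (shorter Y Y≤)
    λ j → subst₂ _↭_ (sym (column-drop-1 j X)) (sym (column-drop-1 j Y)) (perm (suc j))))
  (↭-sym (concat-first-column Y)))
  where
  shorter : ∀ Z → All (λ r → length r ≤ suc M) Z → All (λ r → length r ≤ M) (map (drop 1) Z)
  shorter Z Z≤ = AllP.map⁺ (All.map (λ {r} l → subst (_≤ M) (sym (length-drop 1 r)) (∸-monoˡ-≤ 1 l)) Z≤)

weight-↭ : ∀ X Y → concat X ↭ concat Y → ∀ t → weight X t ≡ weight Y t
weight-↭ X Y p t = ↭-length (filter-↭ (t ≟_) p)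

positive-↭ : ∀ X Y → concat X ↭ concat Y → All (All (1 ≤_)) Y → All (All (1 ≤_)) X
positive-↭ X Y p pos = AllP.concat⁻ (All-resp-↭ (↭-sym p) (AllP.concat⁺ pos))

rows-by-columns : ∀ X Y → map length X ≡ map length Y → (∀ j → column j X ≡ column j Y) → X ≡ Y
rows-by-columns [] [] _ _ = refl
rows-by-columns (r ∷ X) (r′ ∷ Y) lengths cols with l₁ , l₂ ← ∷-injective lengths =
  cong₂ _∷_ (at-ext r r′ (proj₁ ∘ both)) (rows-by-columns X Y l₂ (proj₂ ∘ both))
  where
  both : ∀ j → at r j ≡ at r′ j × column j X ≡ column j Y
  both j = split (at r j) (at r′ j) refl refl (cols j)
    where
    split : ∀ ma mb → at r j ≡ ma → at r′ j ≡ mb →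
      maybe′ _∷_ (λ ys → ys) ma (column j X) ≡ maybe′ _∷_ (λ ys → ys) mb (column j Y) →
      ma ≡ mb × column j X ≡ column j Y
    split nothing nothing _ _ e = refl , e
    split (just a) (just b) _ _ e with refl , e′ ← ∷-injective e = refl , e′
    split (just a) nothing ea eb _ = contradiction (at≡nothing⇒length≤ r′ j eb) (<⇒≱ (subst (j <_) l₁ (at-length r j ea)))
    split nothing (just b) ea eb _ = contradiction (at≡nothing⇒length≤ r j ea) (<⇒≱ (subst (j <_) (sym l₁) (at-length r′ j eb)))

PrefixLess : List ℕ → List ℕ → Set
PrefixLess cs [] = ⊤
PrefixLess [] (e ∷ es) = ⊥
PrefixLess (c ∷ cs) (e ∷ es) = c < e × PrefixLess cs es

PrefixLess-length : ∀ cs es → PrefixLess cs es → length es ≤ length cs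
PrefixLess-length cs [] _ = z≤n
PrefixLess-length (c ∷ cs) (e ∷ es) (_ , p) = s≤s (PrefixLess-length cs es p)

Hall⇒PrefixLess : ∀ cs es → Sorted cs → Sorted es → Hall cs es → PrefixLess cs es
Hall⇒PrefixLess cs [] _ _ _ = tt
Hall⇒PrefixLess [] (e ∷ es) _ _ hall = contradiction (subst (_≤ 0) (count-accept (_≤? e) es ≤-refl) (hall e)) λ ()
Hall⇒PrefixLess (c ∷ cs) (e ∷ es) sc se hall with c <? e
... | yes c<e = c<e , Hall⇒PrefixLess cs es (Linked.tail sc) (Linked.tail se) (Hall-drop [] cs c<e se hall)
... | no c≮e = contradiction (subst₂ _≤_ (count-accept (_≤? e) es ≤-refl) (count-none (_<? e) nothing-below) (hall e)) λ ()
  where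
  nothing-below : All (λ y → ¬ y < e) (c ∷ cs)
  nothing-below = All.map (λ c≤y y<e → c≮e (≤-<-trans c≤y y<e)) (≤-refl ∷ Sorted⇒All≥head sc)

addColumn : Filling → List ℕ → Filling
addColumn X [] = X
addColumn [] (c ∷ cs) = []
addColumn (r ∷ X) (c ∷ cs) = (r ++ [ c ]) ∷ addColumn X cs

FitsOn : ℕ → Filling → List ℕ → Set
FitsOn k X [] = ⊤
FitsOn k [] (c ∷ cs) = ⊥
FitsOn k (r ∷ X) (c ∷ cs) = length r ≡ k × FitsOn k X cs

fitsOn-count : ∀ k X cs → Linked _≥_ (map length X) → All (λ r → length r ≤ k) X →
  length cs ≤ count (k ≤?_) (map length X) → FitsOn k X cs
fitsOn-count k X [] _ _ _ = tt
fitsOn-count k (r ∷ X) (c ∷ cs) desc (r≤k ∷ X≤k) h with k ≤? length r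
... | yes k≤r = ≤-antisym r≤k k≤r ,
  fitsOn-count k X cs (Linked.tail desc) X≤k (≤-pred (subst (_ ≤_) (count-accept (k ≤?_) _ k≤r) h))
... | no k≰r = contradiction (subst (_ ≤_) (trans (count-reject (k ≤?_) _ k≰r) (count-none (k ≤?_) shorter)) h) λ ()
  where
  shorter : All (λ l → ¬ k ≤ l) (map length X)
  shorter = All.map (λ l≤r k≤l → k≰r (≤-trans k≤l l≤r)) (Desc⇒All≤head desc)

module AddColumn (k : ℕ) where

  length-addColumn : ∀ X cs → length (addColumn X cs) ≡ length X
  length-addColumn X [] = refl
  length-addColumn [] (c ∷ cs) = refl
  length-addColumn (r ∷ X) (c ∷ cs) = cong suc (length-addColumn X cs)

  addColumn-bounded : ∀ X cs → FitsOn k X cs → All (λ r → length r ≤ k) X → All (λ r → length r ≤ suc k) (addColumn X cs)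
  addColumn-bounded X [] _ X≤ = All.map m≤n⇒m≤1+n X≤
  addColumn-bounded (r ∷ X) (c ∷ cs) (refl , f) (_ ∷ X≤) = ≤-reflexive (length-snoc r c) ∷ addColumn-bounded X cs f X≤

  column-addColumn-< : ∀ X cs → FitsOn k X cs → ∀ j → j < k → column j (addColumn X cs) ≡ column j X
  column-addColumn-< X [] _ j _ = refl
  column-addColumn-< (r ∷ X) (c ∷ cs) (refl , f) j j<k rewrite at-snoc-< r c j j<k with at r j
  ... | nothing = column-addColumn-< X cs f j j<k
  ... | just a = cong (a ∷_) (column-addColumn-< X cs f j j<k)

  column-addColumn : ∀ X cs → FitsOn k X cs → All (λ r → length r ≤ k) X → column k (addColumn X cs) ≡ cs
  column-addColumn X [] _ X≤ = column-short k X X≤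
  column-addColumn (r ∷ X) (c ∷ cs) (refl , f) (_ ∷ X≤) rewrite at-snoc r c = cong (c ∷_) (column-addColumn X cs f X≤)

  addColumn-desc : ∀ X cs → FitsOn k X cs → All (λ r → length r ≤ k) X → Linked _≥_ (map length X) →
    Linked _≥_ (map length (addColumn X cs))
  addColumn-desc X [] _ _ desc = desc
  addColumn-desc (r ∷ X) (c ∷ cs) (refl , f) (_ ∷ X≤) desc rewrite length-snoc r c =
    Desc-cons (AllP.map⁺ (addColumn-bounded X cs f X≤)) (addColumn-desc X cs f X≤ (Linked.tail desc))

addColumn-strict : ∀ j X cs → FitsOn (suc j) X cs → PrefixLess (column j X) cs → RowsStrict X → RowsStrict (addColumn X cs)
addColumn-strict j X [] _ _ strict = strict
addColumn-strict j (r ∷ X) (c ∷ cs) (lr , f) less (l ∷ ls)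
  with a , ea ← at-defined r j (subst (j <_) (sym lr) ≤-refl)
  with a<c , less′ ← subst (λ z → PrefixLess z (c ∷ cs)) (mapMaybe-∷-just (λ r → at r j) r X ea) less =
  snoc-increasing r (trans (lastOf-at j r lr) ea) a<c l ∷ addColumn-strict j X cs f less′ ls
  where
  snoc-increasing : ∀ (r : List ℕ) {a c} → lastOf r ≡ just a → a < c → Linked _<_ r → Linked _<_ (r ++ [ c ])
  snoc-increasing (x ∷ []) refl a<c _ = a<c ∷ [-]
  snoc-increasing (x ∷ y ∷ r) e a<c (x<y ∷ l) = x<y ∷ snoc-increasing (y ∷ r) e a<c l

module FromColumns (C : ℕ → List ℕ) (less : ∀ j → PrefixLess (C j) (C (suc j))) where

  build : ℕ → Filling
  build zero = singletons (C 0)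
  build (suc k) = addColumn (build k) (C (suc k))

  record Invariant (k : ℕ) (X : Filling) : Set where
    field
      bounded : All (λ r → length r ≤ suc k) X
      desc : Linked _≥_ (map length X)
      columns : ∀ j → j < suc k → column j X ≡ C j
      strict : RowsStrict X
      height : length X ≡ length (C 0)

  singletons-desc : ∀ xs → Linked _≥_ (map length (singletons xs))
  singletons-desc [] = []
  singletons-desc (x ∷ []) = [-]
  singletons-desc (x ∷ y ∷ xs) = ≤-refl ∷ singletons-desc (y ∷ xs)

  invariant : ∀ k → Invariant k (build k)
  invariant zero = record
    { bounded = AllP.map⁺ (All.universal (λ _ → ≤-refl) (C 0))
    ; desc = singletons-desc (C 0)
    ; columns = λ { zero _ → column-singletons (C 0) ; (suc j) (s≤s ()) }
    ; strict = AllP.map⁺ (All.universal (λ _ → [-]) (C 0))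
    ; height = length-map [_] (C 0)
    }
  invariant (suc k) = record
    { bounded = addColumn-bounded X cs fit bounded
    ; desc = addColumn-desc X cs fit bounded desc
    ; columns = columns′
    ; strict = addColumn-strict k X cs fit (subst (λ z → PrefixLess z cs) (sym (columns k ≤-refl)) (less k)) strict
    ; height = trans (length-addColumn X cs) height
    }
    where
    open Invariant (invariant k)
    open AddColumn (suc k)
    X : Filling
    X = build k
    cs : List ℕ
    cs = C (suc k)
    fit : FitsOn (suc k) X cs
    fit = fitsOn-count (suc k) X cs desc bounded (≤-trans (PrefixLess-length (C k) cs (less k))
            (≤-reflexive (trans (cong length (sym (columns k ≤-refl))) (length-column k X))))
    columns′ : ∀ j → j < suc (suc k) → column j (addColumn X cs) ≡ C j
    columns′ j j≤k with m≤n⇒m<n∨m≡n (≤-pred j≤k)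
    ... | inj₁ j<k = trans (column-addColumn-< X cs fit j j<k) (columns j j<k)
    ... | inj₂ refl = column-addColumn X cs fit bounded

sort-columns : ∀ R → RowsStrict R → ∃ λ T → RowsStrict T × Linked _≥_ (map length T) ×
  length T ≡ length (sort (column 0 R)) × (∀ j → column j T ≡ sort (column j R))
sort-columns R strict = build M , strict′ , desc , height , columnsT
  where
  C : ℕ → List ℕ
  C j = sort (column j R)
  less : ∀ j → PrefixLess (C j) (C (suc j))
  less j = Hall⇒PrefixLess (C j) (C (suc j)) (sort-↗ _) (sort-↗ _)
    (Hall-↭ʳ {cs = C j} (↭-sym (sort-↭ _))
      (Hall-↭ˡ {es = column (suc j) R} (↭-sym (sort-↭ _)) (rowsStrict⇒Hall R strict j)))
  M : ℕ
  M = numCols R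
  open FromColumns C less
  open Invariant (invariant M) renaming (strict to strict′)
  columnsT : ∀ j → column j (build M) ≡ C j
  columnsT j with j <? suc M
  ... | yes j≤M = columns j j≤M
  ... | no j≰M = trans (column-short j (build M) (All.map (λ l → ≤-trans l (≮⇒≥ j≰M)) bounded))
      (sym (↭-empty-inv (subst (C j ↭_) (column-short j R (All.map (λ l → ≤-trans l M≤j) (rows≤numCols R))) (sort-↭ _))))
    where
    M≤j : M ≤ j
    M≤j = ≤-trans (n≤1+n M) (≮⇒≥ j≰M)

rows-bounded : ∀ R T → (∀ j → column j R ↭ column j T) → All (λ r → length r ≤ numCols T) R
rows-bounded R T perm = column≡[]⇒short (numCols T) R
  (↭-empty-inv (subst (column (numCols T) R ↭_) (column-short (numCols T) T (rows≤numCols T)) (perm (numCols T))))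

concat-↭-by-columns : ∀ R T → (∀ j → column j R ↭ column j T) → concat R ↭ concat T
concat-↭-by-columns R T perm = concat-↭ (numCols T) R T (rows-bounded R T perm) (rows≤numCols T) perm

RSSYT⇒sorted : ∀ {λ′} T → IsPartition λ′ → RSSYT λ′ T → ∀ j → Sorted (column j T)
RSSYT⇒sorted {λ′} T (_ , desc) ((lengths , _) , _ , weak) j = WeakColumn⇒sorted T j longer (λ i → weak i (suc j))
  where
  longer : ∀ i {r r′} → at T i ≡ just r → at T (suc i) ≡ just r′ → j < length r′ → j < length r
  longer i e₁ e₂ j<r′ = <-≤-trans j<r′
    (Linked⇒at (subst (Linked _≥_) (sym lengths) desc) i (at-map length T i e₁) (at-map length T (suc i) e₂))

sorted⇒RSSYT : ∀ {λ′} T → map length T ≡ λ′ → All (All (1 ≤_)) T → RowsStrict T → (∀ j → Sorted (column j T)) →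
  RSSYT λ′ T
sorted⇒RSSYT T lengths pos strict sorted = (lengths , pos) , strict , weak
  where
  weak : ∀ i j a b → cell T i j ≡ just a → cell T (suc i) j ≡ just b → a ≤ b
  weak i (suc j) = sorted⇒WeakColumn T j (sorted j) i

SSYRT⇒GreedyTableau : ∀ {α} R → IsComposition α → SSYRT α R → GreedyTableau R
SSYRT⇒GreedyTableau R comp ((refl , _) , strict , first , triple) = record
  { nonempty = nonempty
  ; strict = strict
  ; first-sorted = WeakColumn⇒sorted R 0 (λ i e₁ _ _ → All-at nonempty i e₁) first
  ; blocked = TripleBounded⇒blocked R triple
  }
  where
  nonempty : All (λ r → 1 ≤ length r) R
  nonempty = AllP.map⁻ comp

GreedyTableau⇒SSYRT : ∀ R → GreedyTableau R → All (All (1 ≤_)) R → SSYRT (map length R) R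
GreedyTableau⇒SSYRT R tab pos = (refl , pos) , strict , sorted⇒WeakColumn R 0 first-sorted ,
  λ i j k _ i<j _ _ _ → blocked⇒Triple R blocked i j k i<j
  where open GreedyTableau tab


record ρImage (T : Filling) : Set where
  field
    image : Filling
    ρ≡image : ρ T ≡ just image
    tableau : GreedyTableau image
    columns-↭ : ∀ j → column j image ↭ column j T

ρ-image-spec : ∀ {λ′} T → IsPartition λ′ → RSSYT λ′ T → ρImage T
ρ-image-spec T part rssyt@(_ , strict , _) = spec (greedy-tableau-exists T strict sorted)
  where
  sorted : ∀ j → Sorted (column j T)
  sorted = RSSYT⇒sorted T part rssyt
  spec : (∃ λ R → GreedyTableau R × (∀ j → column j R ↭ column j T)) → ρImage T
  spec (R , tab , perm) = record { image = R ; ρ≡image = ρ≡just T R sorted tab perm ; tableau = tab ; columns-↭ = perm }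

ρ-image : ∀ λ′ → IsPartition λ′ → (T : Filling) → RSSYT λ′ T →
  Σ Filling (λ R → ρ T ≡ just R × Σ (List ℕ) (λ α → IsComposition α × shape α ≡ λ′ × SSYRT α R
    × ((t : ℕ) → weight R t ≡ weight T t)))
ρ-image λ′ part@(parts-pos , desc) T rssyt@((lengths , pos) , _) =
  R , ρ≡image , map length R , AllP.map⁺ nonempty ,
  trans (shape-by-columns R T height (subst (Linked _≥_) (sym lengths) desc) columns-↭) lengths ,
  GreedyTableau⇒SSYRT R tableau (positive-↭ R T entries pos) , weight-↭ R T entries
  where
  open ρImage (ρ-image-spec T part rssyt) renaming (image to R)
  open GreedyTableau tableau
  entries : concat R ↭ concat T
  entries = concat-↭-by-columns R T columns-↭
  height : length R ≡ length T
  height = trans (sym (length-column₀ R nonempty)) (trans (↭-length (columns-↭ 0))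
    (length-column₀ T (AllP.map⁻ (subst (All (1 ≤_)) (sym lengths) parts-pos))))

ρ-injective : ∀ λ′ → IsPartition λ′ → (T T′ : Filling) → RSSYT λ′ T → RSSYT λ′ T′ → ρ T ≡ ρ T′ → T ≡ T′
ρ-injective λ′ part T T′ rssyt@((lengths , _) , _) rssyt′@((lengths′ , _) , _) ρT≡ρT′ =
  rows-by-columns T T′ (trans lengths (sym lengths′)) λ j →
    sorted-↭⇒≡ (RSSYT⇒sorted T part rssyt j) (RSSYT⇒sorted T′ part rssyt′ j)
      (↭-trans (↭-sym (I.columns-↭ j)) (subst (λ X → column j X ↭ column j T′) (sym same-image) (I′.columns-↭ j)))
  where
  module I = ρImage (ρ-image-spec T part rssyt)
  module I′ = ρImage (ρ-image-spec T′ part rssyt′)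
  same-image : I.image ≡ I′.image
  same-image = just-injective (trans (sym I.ρ≡image) (trans ρT≡ρT′ I′.ρ≡image))

ρ-surjective : ∀ λ′ → IsPartition λ′ → (α : List ℕ) → IsComposition α → shape α ≡ λ′ → (R : Filling) → SSYRT α R →
  Σ Filling (λ T → RSSYT λ′ T × ρ T ≡ just R)
ρ-surjective λ′ part α comp shape≡ R ssyrt@((refl , pos) , strict , _)
  with T , strictT , desc , height , columnsT ← sort-columns R strict =
  T , sorted⇒RSSYT T lengths (positive-↭ T R (concat-↭-by-columns T R (↭-sym ∘ perm)) pos) strictT sortedT ,
  ρ≡just T R sortedT tab perm
  where
  tab : GreedyTableau R
  tab = SSYRT⇒GreedyTableau R comp ssyrt
  perm : ∀ j → column j R ↭ column j T
  perm j = subst (column j R ↭_) (sym (columnsT j)) (↭-sym (sort-↭ _))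
  sortedT : ∀ j → Sorted (column j T)
  sortedT j = subst Sorted (sym (columnsT j)) (sort-↗ _)
  same-height : length R ≡ length T
  same-height = trans (sym (length-column₀ R (GreedyTableau.nonempty tab)))
    (trans (sym (↭-length (sort-↭ (column 0 R)))) (sym height))
  lengths : map length T ≡ λ′
  lengths = trans (sym (shape-by-columns R T same-height desc perm)) shape≡

lemma1 : (λ′ : List ℕ) → IsPartition λ′ →
    ((T : Filling) → RSSYT λ′ T →
        Σ Filling (λ R → ρ T ≡ just R ×
          Σ (List ℕ) (λ α → IsComposition α × shape α ≡ λ′ × SSYRT α R
            × ((t : ℕ) → weight R t ≡ weight T t))))
    × ((T T′ : Filling) → RSSYT λ′ T → RSSYT λ′ T′ → ρ T ≡ ρ T′ → T ≡ T′)
    × ((α : List ℕ) → IsComposition α → shape α ≡ λ′ → (R : Filling) → SSYRT α R →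
        Σ Filling (λ T → RSSYT λ′ T × ρ T ≡ just R))
lemma1 λ′ part = ρ-image λ′ part , ρ-injective λ′ part , ρ-surjective λ′ part
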